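{- In any of the calculi CCS, ABC, ABCd, CCSS, CCSS$'$ described below, for $\chi\in\mathit{Tr}^{s\bullet}$ and $\zeta\in\mathit{Tr}$: if $\chi\smile^{\bullet}_s\zeta$ then $\chi\smile^{\bullet}\zeta$.
   Context: Fix sets $\mathcal A$ (agent identifiers), $\mathcal C$ (handshake names), $\mathcal B$ (broadcast names), $\mathcal S$ (signals); $\bar{\mathcal C}=\{\bar c\mid c\in\mathcal C\}$, $\bar{\mathcal S}=\{\bar s\mid s\in\mathcal S\}$, $\bar{\bar x}=x$. Processes: $P::=\mathbf 0\mid\alpha.P\mid P+P\mid P|P\mid P\backslash L\mid P[f]\mid A$, and in CCSS, CCSS$'$ also $P\,\hat{}\,s$ ($s\in\mathcal S$); each $A\in\mathcal A$ has an equation $A\stackrel{def}{=}P_A$ (guarded in ABC, ABCd); $L\subseteq\mathcal C$ ($L\subseteq\mathcal C\cup\mathcal S$ in CCSS, CCSS$'$); $f$ maps $\mathcal C\to\mathcal C$, $\mathcal B\to\mathcal B$, $\mathcal S\to\mathcal S$, extended by $f(\bar c)=\overline{f(c)}$, $f(b!)=f(b)!$, $f(b?)=f(b)?$, $f(\tau)=\tau$. Actions/labels: CCS: $\mathit{Act}=\mathcal L=\mathcal C\cup\bar{\mathcal C}\cup\{\tau\}$; ABC: $\mathit{Act}=\mathcal L=\{b!,b?\mid b\in\mathcal B\}\cup\mathcal C\cup\bar{\mathcal C}\cup\{\tau\}$; ABCd: same $\mathit{Act}$, $\mathcal L=\mathit{Act}\cup\{b{:}\mid b\in\mathcal B\}$;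 CCSS: $\mathit{Act}=\mathcal L=\mathcal S\cup\mathcal C\cup\bar{\mathcal C}\cup\{\tau\}$; CCSS$'$: same $\mathit{Act}$, $\mathcal L=\mathit{Act}\cup\bar{\mathcal S}$. $R=\{b?\mid b\in\mathcal B\}$ in ABC, ABCd, $R=\emptyset$ otherwise. Rules (all calculi): $\alpha.P\xrightarrow{\alpha}P$; from $P\xrightarrow{\alpha}P'$: $P+Q\xrightarrow{\alpha}P'$, $Q+P\xrightarrow{\alpha}P'$; from $P\xrightarrow{\eta}P'$: $P|Q\xrightarrow{\eta}P'|Q$, $Q|P\xrightarrow{\eta}Q|P'$; from $P\xrightarrow{c}P'$, $Q\xrightarrow{\bar c}Q'$: $P|Q\xrightarrow{\tau}P'|Q'$; from $P\xrightarrow{\ell}P'$: $P\backslash L\xrightarrow{\ell}P'\backslash L$ if $\ell\notin L\cup\bar L$, and $P[f]\xrightarrow{f(\ell)}P'[f]$; from $P_A\xrightarrow{\alpha}P'$: $A\xrightarrow{\alpha}P'$. Here $\alpha\in\mathit{Act}$, $\ell\in\mathcal L$, $c\in\mathcal C\cup\bar{\mathcal C}$ (in CCSS$'$ also $\mathcal S\cup\bar{\mathcal S}$), $\eta$ over $\mathcal C\cup\bar{\mathcal C}\cup\{\tau\}$ in ABC/ABCd, over $\mathit{Act}$ in CCS/CCSS, over $\mathcal L$ in CCSS$'$. ABC adds: from $P\xrightarrow{b\sharp_1}P'$ and $Q$ with no $b?$-transition: $P|Q\xrightarrow{b\sharp_1}P'|Q$, $Q|P\xrightarrow{b\sharp_1}Q|P'$;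 from $P\xrightarrow{b\sharp_1}P'$, $Q\xrightarrow{b\sharp_2}Q'$: $P|Q\xrightarrow{b\sharp}P'|Q'$, $\sharp=\sharp_1\circ\sharp_2$ with $!\circ?=?\circ!=!$, $?\circ?=?$, $!\circ!$ undefined. ABCd adds (instead): $\mathbf 0\xrightarrow{b:}\mathbf 0$; $\alpha.P\xrightarrow{b:}\alpha.P$ ($\alpha\ne b?$); from $P\xrightarrow{b:}P'$, $Q\xrightarrow{b:}Q'$: $P+Q\xrightarrow{b:}P'+Q'$; the synchronisation rule with $\sharp_i\in\{!,?,:\}$, additionally $!\circ:=:\circ!=!$, $?\circ:=:\circ?=?$, $:\circ:=:$; from $P_A\xrightarrow{b:}P'$: $A\xrightarrow{b:}A$. CCSS adds a predicate $P\curvearrowright s$: $(P\,\hat{}\,s)\curvearrowright s$; from $P\curvearrowright s$: $(P+Q),(Q+P),(P|Q),(Q|P),(P\,\hat{}\,r)\curvearrowright s$, $(P\backslash L)\curvearrowright s$ if $s\notin L$, $P[f]\curvearrowright f(s)$, $A\curvearrowright s$ if $P=P_A$; transitions: from $P\xrightarrow{\alpha}P'$: $P\,\hat{}\,r\xrightarrow{\alpha}P'$; from $P\curvearrowright s$, $Q\xrightarrow{s}Q'$: $P|Q\xrightarrow{\tau}P|Q'$; from $P\xrightarrow{s}P'$, $Q\curvearrowright s$: $P|Q\xrightarrow{\tau}P'|Q$. CCSS$'$ adds: $P\,\hat{}\,s\xrightarrow{\bar s}P\,\hat{}\,s$; from $P\xrightarrow{\bar s}P'$: $P+Q\xrightarrow{\bar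 s}P'+Q$, $Q+P\xrightarrow{\bar s}Q+P'$, $P\,\hat{}\,r\xrightarrow{\bar s}P'\,\hat{}\,r$; from $P\xrightarrow{\alpha}P'$: $P\,\hat{}\,r\xrightarrow{\alpha}P'$; from $P_A\xrightarrow{\bar s}P'$: $A\xrightarrow{\bar s}A$. $\mathit{Tr}$: derivations (proof trees) of transitions, with source, target, label of the derived transition; named $\overset{\alpha}{\to}P$ (prefix axiom), $\chi+Q$, $P+\chi$, $\chi|Q$, $P|\zeta$, $\chi|\zeta$ (any binary synchronisation), $\chi\backslash L$, $\chi[f]$, $A{:}\chi$, $\chi\,\hat{}\,r$; emission derivations $P\!\uparrow\!s$ (axiom) and lifted ones named likewise; ABCd: $b{:}\mathbf 0$, $b{:}\alpha.P$, $\chi+v$. An emission derivation of $P\curvearrowright s$ has source $P$, label $\bar s$. $\mathit{Tr}^\bullet$: derivations with label in $\mathit{Act}\setminus R$. $\mathit{Tr}^{s\bullet}$: emission derivations, transition derivations labelled in $\bar{\mathcal S}$, and those labelled in $\mathit{Act}\setminus\{b?\mid b\in\mathcal B\}$. Synchrons: $\mathit{Arg}=\{+_L,+_R,|_L,|_R,\backslash L,[f],A{:},\hat{}\,r\}$; a synchron is $\sigma(\overset{\alpha}{\to}P)$, $\sigma(P\!\uparrow\!s)$ or $\sigma(b{:})$, $\sigma\in\mathit{Arg}^*$. $\varsigma(\overset{\alpha}{\to}P)=\{(\overset{\alpha}{\to}P)\}$, $\varsigma(P\!\uparrow\!s)=\{(P\!\uparrow\!s)\}$, $\varsigma(b{:}\mathbf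 0)=\varsigma(b{:}\alpha.P)=\{(b{:})\}$, $\varsigma(\chi+Q)=+_L\varsigma(\chi)$, $\varsigma(P+\chi)=+_R\varsigma(\chi)$, $\varsigma(\chi+v)=+_L\varsigma(\chi)\cup+_R\varsigma(v)$, $\varsigma(\chi|Q)=|_L\varsigma(\chi)$, $\varsigma(P|\zeta)=|_R\varsigma(\zeta)$, $\varsigma(\chi|\zeta)=|_L\varsigma(\chi)\cup|_R\varsigma(\zeta)$, $\varsigma(\chi\backslash L)=\backslash L\,\varsigma(\chi)$, $\varsigma(\chi[f])=[f]\varsigma(\chi)$, $\varsigma(A{:}\chi)=A{:}\varsigma(\chi)$, $\varsigma(\chi\,\hat{}\,r)=\hat{}\,r\,\varsigma(\chi)$ (arguments applied elementwise). $a\varsigma(\chi)$: synchrons of form $\sigma(\overset{\alpha}{\to}P)$. For $\chi\in\mathit{Tr}^{s\bullet}$: $n\varsigma(\chi)$ is the unique synchron of form $\sigma(\overset{b!}{\to}P)$ if $\ell(\chi)=b!$, and $\varsigma(\chi)$ otherwise. $+_L,+_R,A{:},\hat{}\,r$ are dynamic, the others static; $\mathrm{static}(\sigma)$ deletes dynamic arguments. For strings: $x\leadsto x'$ iff $x'=x$ or $x=\sigma_1|_Dx_2$, $x'=\mathrm{static}(\sigma_1)|_Dx_2$; $x\smile_dy$ iff $x=\sigma_1|_Dx_2$, $y=\sigma_1|_Ey_2$, $\{D,E\}=\{L,R\}$; $x\smile y$ iff $x_0\leadsto x$, $x_0\smile_dy_0$, $y_0\leadsto y$ for some $x_0,y_0$.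 For $\chi\in\mathit{Tr}^{s\bullet}$, $\zeta\in\mathit{Tr}$: $\chi\smile^{\bullet}\zeta$ iff $\varsigma\smile\upsilon$ for all $\varsigma\in n\varsigma(\chi)$, $\upsilon\in a\varsigma(\zeta)$. Static components: the static component $c(\varsigma)$ of a synchron $\varsigma$ is its largest prefix consisting of static arguments only (a string in $\mathit{Arg}^*$). $npc(\chi)=\{c(\varsigma)\mid\varsigma\in n\varsigma(\chi)\}$, $afc(\zeta)=\{c(\upsilon)\mid\upsilon\in a\varsigma(\zeta)\}$. $\chi\smile^{\bullet}_s\zeta$ iff $\gamma\smile\delta$ for all $\gamma\in npc(\chi)$, $\delta\in afc(\zeta)$. -}

module Defs where

open import Data.Bool using (Bool; true; false; T; if_then_else_)
open import Data.Empty using (⊥)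
open import Data.Unit using (⊤)
open import Data.Product using (Σ; ∃; _×_; _,_)
open import Data.Sum using (_⊎_; inj₁; inj₂)
open import Data.List using (List; []; _∷_; _++_; map; [_])
open import Data.List.Membership.Propositional using (_∈_)
open import Relation.Binary.PropositionalEquality using (_≡_; _≢_)
open import Relation.Nullary using (¬_)

data Calc : Set where
  CCS ABC ABCd CCSS CCSS′ : Calc

hasB : Calc → Bool
hasB ABC  = true
hasB ABCd = true
hasB _    = false

hasS : Calc → Bool
hasS CCSS  = true
hasS CCSS′ = true
hasS _     = false

isABC : Calc → Bool
isABC ABC = true
isABC _   = false

isABCd : Calc → Bool
isABCd ABCd = true
isABCd _    = false

isCCSS : Calc → Bool
isCCSS CCSS = true
isCCSS _    = false

isCCSS′ : Calc → Bool
isCCSS′ CCSS′ = true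
isCCSS′ _     = false

data Side : Set where
  left right : Side

-- Syntax, synchrons and the string relations (no semantics needed)
-- 𝒜 agent identifiers, 𝒞 handshake names, ℬ broadcast names, 𝒮 signals

module Syntax (𝒜 𝒞 ℬ 𝒮 : Set) (k : Calc) where

  data Act : Set where
    τ  : Act
    ch : 𝒞 → Act
    co : 𝒞 → Act                      -- c̄
    bs : T (hasB k) → ℬ → Act         -- b!
    br : T (hasB k) → ℬ → Act         -- b?
    sg : T (hasS k) → 𝒮 → Act

  -- 𝓛 : Act plus b: (ABCd) and s̄ (signal calculi; s̄ only occurs as a
  -- transition label in CCSS′, and as the label of emission derivations)
  data Lab : Set where
    act  : Act → Lab
    disc : T (isABCd k) → ℬ → Lab     -- b:
    sbar : T (hasS k) → 𝒮 → Lab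

  data RName : Set where
    rc : 𝒞 → RName
    rs : T (hasS k) → 𝒮 → RName

  -- a restriction set L (a subset, given as a predicate)
  RSet : Set₁
  RSet = RName → Set

  record Ren : Set where
    field
      fC : 𝒞 → 𝒞
      fB : ℬ → ℬ
      fS : 𝒮 → 𝒮
  open Ren public

  data Proc : Set₁ where
    𝟎     : Proc
    _∙_   : Act → Proc → Proc
    _⊕_   : Proc → Proc → Proc
    _∣_   : Proc → Proc → Proc
    _∖_   : Proc → RSet → Proc
    _⟦_⟧  : Proc → Ren → Proc
    ag    : 𝒜 → Proc
    sigop : T (hasS k) → Proc → 𝒮 → Proc      -- P ^ s

  Guarded : Proc → Set
  Guarded 𝟎 = ⊤
  Guarded (α ∙ P) = ⊤
  Guarded (P ⊕ Q) = Guarded P × Guarded Q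
  Guarded (P ∣ Q) = Guarded P × Guarded Q
  Guarded (P ∖ L) = Guarded P
  Guarded (P ⟦ f ⟧) = Guarded P
  Guarded (ag A) = ⊥
  Guarded (sigop _ P s) = Guarded P

  renAct : Ren → Act → Act
  renAct f τ = τ
  renAct f (ch c) = ch (fC f c)
  renAct f (co c) = co (fC f c)
  renAct f (bs p b) = bs p (fB f b)
  renAct f (br p b) = br p (fB f b)
  renAct f (sg p s) = sg p (fS f s)

  renLab : Ren → Lab → Lab
  renLab f (act α) = act (renAct f α)
  renLab f (disc p b) = disc p (fB f b)
  renLab f (sbar p s) = sbar p (fS f s)

  Blocked : RSet → Lab → Set
  Blocked L (act (ch c)) = L (rc c)
  Blocked L (act (co c)) = L (rc c)
  Blocked L (act (sg p s)) = L (rs p s)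
  Blocked L (sbar p s) = L (rs p s)
  Blocked L _ = ⊥

  -- the labels η allowed in the interleaving rules for |
  ηOK : Lab → Set
  ηOK (act τ) = ⊤
  ηOK (act (ch _)) = ⊤
  ηOK (act (co _)) = ⊤
  ηOK (act (sg _ _)) = ⊤
  ηOK (act (bs _ _)) = ⊥
  ηOK (act (br _ _)) = ⊥
  ηOK (disc _ _) = ⊥
  ηOK (sbar _ _) = T (isCCSS′ k)

  data Compl : Lab → Lab → Set where
    c-co : ∀ c → Compl (act (ch c)) (act (co c))
    co-c : ∀ c → Compl (act (co c)) (act (ch c))
    s-sb : T (isCCSS′ k) → ∀ p q s → Compl (act (sg p s)) (sbar q s)
    sb-s : T (isCCSS′ k) → ∀ p q s → Compl (sbar q s) (act (sg p s))

  data IsBC (b : ℬ) : Lab → Set where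
    isBs : ∀ p → IsBC b (act (bs p b))
    isBr : ∀ p → IsBC b (act (br p b))

  data BComb : Lab → Lab → Lab → Set where
    !? : ∀ p b → BComb (act (bs p b)) (act (br p b)) (act (bs p b))
    ?! : ∀ p b → BComb (act (br p b)) (act (bs p b)) (act (bs p b))
    ?? : ∀ p b → BComb (act (br p b)) (act (br p b)) (act (br p b))
    !: : ∀ p q b → BComb (act (bs p b)) (disc q b) (act (bs p b))
    :! : ∀ p q b → BComb (disc q b) (act (bs p b)) (act (bs p b))
    ?: : ∀ p q b → BComb (act (br p b)) (disc q b) (act (br p b))
    :? : ∀ p q b → BComb (disc q b) (act (br p b)) (act (br p b))
    :: : ∀ q b → BComb (disc q b) (disc q b) (disc q b)

  NotRecv : ℬ → Act → Set
  NotRecv b α = ∀ p → α ≢ br p b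

  data Arg : Set₁ where
    plus  : Side → Arg
    par   : Side → Arg
    resA  : RSet → Arg
    renA  : Ren → Arg
    agA   : 𝒜 → Arg
    sigA  : 𝒮 → Arg

  isStatic : Arg → Bool
  isStatic (plus _) = false
  isStatic (par _)  = true
  isStatic (resA _) = true
  isStatic (renA _) = true
  isStatic (agA _)  = false
  isStatic (sigA _) = false

  static : List Arg → List Arg
  static [] = []
  static (a ∷ σ) = if isStatic a then a ∷ static σ else static σ

  staticPrefix : List Arg → List Arg
  staticPrefix [] = []
  staticPrefix (a ∷ σ) = if isStatic a then a ∷ staticPrefix σ else []

  data Base : Set₁ where
    bpre  : Act → Proc → Base
    bemit : Proc → 𝒮 → Base
    bdisc : ℬ → Base

  record Synchron : Set₁ where
    constructor _⦅_⦆
    field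
      args : List Arg
      base : Base
  open Synchron public

  push : Arg → List Synchron → List Synchron
  push a = map (λ { (σ ⦅ b ⦆) → (a ∷ σ) ⦅ b ⦆ })

  data IsPre : Base → Set₁ where
    isPre : ∀ α P → IsPre (bpre α P)

  data IsSendBase : Base → Set₁ where
    isSendBase : ∀ p b P → IsSendBase (bpre (bs p b) P)

  data IsSend : Lab → Set where
    isSend : ∀ p b → IsSend (act (bs p b))

  cmp : Synchron → List Arg
  cmp ς = staticPrefix (args ς)

  -- strings (over Arg, ending possibly in a synchron's base)

  Sym : Set₁
  Sym = Arg ⊎ Base

  emb : List Arg → List Sym
  emb = map inj₁

  str : Synchron → List Sym
  str (σ ⦅ b ⦆) = emb σ ++ [ inj₂ b ]

  _↝_ : List Sym → List Sym → Set₁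
  x ↝ x′ = x′ ≡ x ⊎
    (Σ (List Arg) λ σ₁ → Σ Side λ D → Σ (List Sym) λ x₂ →
       x ≡ emb σ₁ ++ inj₁ (par D) ∷ x₂ ×
       x′ ≡ emb (static σ₁) ++ inj₁ (par D) ∷ x₂)

  -- x ⌣_d y   ({D,E} = {L,R} iff D ≢ E)
  _⌣d_ : List Sym → List Sym → Set₁
  x ⌣d y =
    Σ (List Arg) λ σ₁ → Σ Side λ D → Σ Side λ E →
    Σ (List Sym) λ x₂ → Σ (List Sym) λ y₂ →
      D ≢ E × x ≡ emb σ₁ ++ inj₁ (par D) ∷ x₂
            × y ≡ emb σ₁ ++ inj₁ (par E) ∷ y₂

  _⌣_ : List Sym → List Sym → Set₁
  x ⌣ y = Σ (List Sym) λ x₀ → Σ (List Sym) λ y₀ →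
    x₀ ↝ x × x₀ ⌣d y₀ × y₀ ↝ y

-- Semantics of a calculus with defining equations  A ≝ def A

module Semantics {𝒜 𝒞 ℬ 𝒮 : Set} {k : Calc}
                 {def : 𝒜 → Syntax.Proc 𝒜 𝒞 ℬ 𝒮 k} where

  open Syntax 𝒜 𝒞 ℬ 𝒮 k

  data CanRecv (b : ℬ) : Proc → Set₁ where
    cr-pre  : ∀ {p P} → CanRecv b (br p b ∙ P)
    cr-sumL : ∀ {P Q} → CanRecv b P → CanRecv b (P ⊕ Q)
    cr-sumR : ∀ {P Q} → CanRecv b P → CanRecv b (Q ⊕ P)
    cr-parL : ∀ {P Q} → CanRecv b P → CanRecv b (P ∣ Q)
    cr-parR : ∀ {P Q} → CanRecv b P → CanRecv b (Q ∣ P)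
    cr-res  : ∀ {P L} → CanRecv b P → CanRecv b (P ∖ L)
    cr-ren  : ∀ {P f b′} → fB f b′ ≡ b → CanRecv b′ P → CanRecv b (P ⟦ f ⟧)
    cr-ag   : ∀ {A} → CanRecv b (def A) → CanRecv b (ag A)
    cr-sig  : ∀ {p P r} → CanRecv b P → CanRecv b (sigop p P r)

  mutual
    data Emits : Proc → 𝒮 → Set₁ where
      e-ax   : T (isCCSS k) → ∀ p P s → Emits (sigop p P s) s
      e-sumL : ∀ {P Q s} → Emits P s → Emits (P ⊕ Q) s
      e-sumR : ∀ {P Q s} → Emits P s → Emits (Q ⊕ P) s
      e-parL : ∀ {P Q s} → Emits P s → Emits (P ∣ Q) s
      e-parR : ∀ {P Q s} → Emits P s → Emits (Q ∣ P) s
      e-sig  : ∀ {p P r s} → Emits P s → Emits (sigop p P r) s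
      e-res  : ∀ {P L s} (p : T (hasS k)) → ¬ L (rs p s) → Emits P s → Emits (P ∖ L) s
      e-ren  : ∀ {P f s} → Emits P s → Emits (P ⟦ f ⟧) (fS f s)
      e-ag   : ∀ {A s} → Emits (def A) s → Emits (ag A) s

    data _—[_]→_ : Proc → Lab → Proc → Set₁ where
      t-pre  : ∀ α P → (α ∙ P) —[ act α ]→ P
      t-sumL : ∀ {P Q P′ α} → P —[ act α ]→ P′ → (P ⊕ Q) —[ act α ]→ P′
      t-sumR : ∀ {P Q P′ α} → P —[ act α ]→ P′ → (Q ⊕ P) —[ act α ]→ P′
      t-parL : ∀ {P Q P′ ℓ} → ηOK ℓ → P —[ ℓ ]→ P′ → (P ∣ Q) —[ ℓ ]→ (P′ ∣ Q)
      t-parR : ∀ {P Q P′ ℓ} → ηOK ℓ → P —[ ℓ ]→ P′ → (Q ∣ P) —[ ℓ ]→ (Q ∣ P′)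
      t-comm : ∀ {P Q P′ Q′ ℓ ℓ′} → Compl ℓ ℓ′ →
               P —[ ℓ ]→ P′ → Q —[ ℓ′ ]→ Q′ → (P ∣ Q) —[ act τ ]→ (P′ ∣ Q′)
      t-res  : ∀ {P P′ L ℓ} → ¬ Blocked L ℓ → P —[ ℓ ]→ P′ → (P ∖ L) —[ ℓ ]→ (P′ ∖ L)
      t-ren  : ∀ {P P′ f ℓ} → P —[ ℓ ]→ P′ → (P ⟦ f ⟧) —[ renLab f ℓ ]→ (P′ ⟦ f ⟧)
      t-ag   : ∀ {A P′ α} → def A —[ act α ]→ P′ → ag A —[ act α ]→ P′
      t-bcL  : ∀ {P Q P′ ℓ b} → T (isABC k) → IsBC b ℓ →
               P —[ ℓ ]→ P′ → ¬ CanRecv b Q → (P ∣ Q) —[ ℓ ]→ (P′ ∣ Q)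
      t-bcR  : ∀ {P Q P′ ℓ b} → T (isABC k) → IsBC b ℓ →
               P —[ ℓ ]→ P′ → ¬ CanRecv b Q → (Q ∣ P) —[ ℓ ]→ (Q ∣ P′)
      t-bsync : ∀ {P Q P′ Q′ ℓ₁ ℓ₂ ℓ} → BComb ℓ₁ ℓ₂ ℓ →
               P —[ ℓ₁ ]→ P′ → Q —[ ℓ₂ ]→ Q′ → (P ∣ Q) —[ ℓ ]→ (P′ ∣ Q′)
      t-d0   : ∀ q b → 𝟎 —[ disc q b ]→ 𝟎
      t-dpre : ∀ q b α P → NotRecv b α → (α ∙ P) —[ disc q b ]→ (α ∙ P)
      t-dsum : ∀ {P Q P′ Q′ q b} → P —[ disc q b ]→ P′ → Q —[ disc q b ]→ Q′ →
               (P ⊕ Q) —[ disc q b ]→ (P′ ⊕ Q′)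
      t-dag  : ∀ {A P′ q b} → def A —[ disc q b ]→ P′ → ag A —[ disc q b ]→ ag A
      t-sig  : ∀ {p P P′ r α} → P —[ act α ]→ P′ → sigop p P r —[ act α ]→ P′
      t-sgL  : ∀ {P Q Q′ p s} → T (isCCSS k) → Emits P s →
               Q —[ act (sg p s) ]→ Q′ → (P ∣ Q) —[ act τ ]→ (P ∣ Q′)
      t-sgR  : ∀ {P Q P′ p s} → T (isCCSS k) → P —[ act (sg p s) ]→ P′ →
               Emits Q s → (P ∣ Q) —[ act τ ]→ (P′ ∣ Q)
      t-emit : T (isCCSS′ k) → ∀ p q P s → sigop p P s —[ sbar q s ]→ sigop p P s
      t-ssumL : ∀ {P Q P′ q s} → P —[ sbar q s ]→ P′ → (P ⊕ Q) —[ sbar q s ]→ (P′ ⊕ Q)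
      t-ssumR : ∀ {P Q P′ q s} → P —[ sbar q s ]→ P′ → (Q ⊕ P) —[ sbar q s ]→ (Q ⊕ P′)
      t-ssig : ∀ {p P P′ r q s} → P —[ sbar q s ]→ P′ →
               sigop p P r —[ sbar q s ]→ sigop p P′ r
      t-sag  : ∀ {A P′ q s} → def A —[ sbar q s ]→ P′ → ag A —[ sbar q s ]→ ag A

  record Tr : Set₁ where
    constructor tr
    field
      {src} : Proc
      {lab} : Lab
      {tgt} : Proc
      deriv : src —[ lab ]→ tgt

  InS : Lab → Set
  InS (act (br _ _)) = ⊥
  InS (act _) = ⊤
  InS (disc _ _) = ⊥
  InS (sbar _ _) = ⊤

  data TrS : Set₁ where
    emission : ∀ {P s} → Emits P s → TrS
    trans    : ∀ {P ℓ P′} → P —[ ℓ ]→ P′ → InS ℓ → TrS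

  mutual
    ςE : ∀ {P s} → Emits P s → List Synchron
    ςE (e-ax _ p P s) = [ [] ⦅ bemit P s ⦆ ]
    ςE (e-sumL e) = push (plus left) (ςE e)
    ςE (e-sumR e) = push (plus right) (ςE e)
    ςE (e-parL e) = push (par left) (ςE e)
    ςE (e-parR e) = push (par right) (ςE e)
    ςE (e-sig {r = r} e) = push (sigA r) (ςE e)
    ςE (e-res {L = L} _ _ e) = push (resA L) (ςE e)
    ςE (e-ren {f = f} e) = push (renA f) (ςE e)
    ςE (e-ag {A = A} e) = push (agA A) (ςE e)

    ςT : ∀ {P ℓ P′} → P —[ ℓ ]→ P′ → List Synchron
    ςT (t-pre α P) = [ [] ⦅ bpre α P ⦆ ]
    ςT (t-sumL χ) = push (plus left) (ςT χ)
    ςT (t-sumR χ) = push (plus right) (ςT χ)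
    ςT (t-parL _ χ) = push (par left) (ςT χ)
    ςT (t-parR _ χ) = push (par right) (ςT χ)
    ςT (t-comm _ χ ζ) = push (par left) (ςT χ) ++ push (par right) (ςT ζ)
    ςT (t-res {L = L} _ χ) = push (resA L) (ςT χ)
    ςT (t-ren {f = f} χ) = push (renA f) (ςT χ)
    ςT (t-ag {A = A} χ) = push (agA A) (ςT χ)
    ςT (t-bcL _ _ χ _) = push (par left) (ςT χ)
    ςT (t-bcR _ _ χ _) = push (par right) (ςT χ)
    ςT (t-bsync _ χ ζ) = push (par left) (ςT χ) ++ push (par right) (ςT ζ)
    ςT (t-d0 _ b) = [ [] ⦅ bdisc b ⦆ ]
    ςT (t-dpre _ b _ _ _) = [ [] ⦅ bdisc b ⦆ ]
    ςT (t-dsum χ v) = push (plus left) (ςT χ) ++ push (plus right) (ςT v)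
    ςT (t-dag {A = A} χ) = push (agA A) (ςT χ)
    ςT (t-sig {r = r} χ) = push (sigA r) (ςT χ)
    ςT (t-sgL _ e ζ) = push (par left) (ςE e) ++ push (par right) (ςT ζ)
    ςT (t-sgR _ χ e) = push (par left) (ςT χ) ++ push (par right) (ςE e)
    ςT (t-emit _ p q P s) = [ [] ⦅ bemit P s ⦆ ]
    ςT (t-ssumL χ) = push (plus left) (ςT χ)
    ςT (t-ssumR χ) = push (plus right) (ςT χ)
    ςT (t-ssig {r = r} χ) = push (sigA r) (ςT χ)
    ςT (t-sag {A = A} χ) = push (agA A) (ςT χ)

  _∈aς_ : Synchron → Tr → Set₁
  υ ∈aς ζ = υ ∈ ςT (Tr.deriv ζ) × IsPre (base υ)

  _∈nς_ : Synchron → TrS → Set₁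
  ς ∈nς emission e = ς ∈ ςE e
  _∈nς_ ς (trans {ℓ = ℓ} χ _) = ς ∈ ςT χ × (IsSend ℓ → IsSendBase (base ς))

  _∈npc_ : List Arg → TrS → Set₁
  γ ∈npc χ = Σ Synchron λ ς → ς ∈nς χ × γ ≡ cmp ς

  _∈afc_ : List Arg → Tr → Set₁
  δ ∈afc ζ = Σ Synchron λ υ → υ ∈aς ζ × δ ≡ cmp υ

  _⌣•_ : TrS → Tr → Set₁
  χ ⌣• ζ = ∀ ς υ → ς ∈nς χ → υ ∈aς ζ → str ς ⌣ str υ

  _⌣•s_ : TrS → Tr → Set₁
  χ ⌣•s ζ = ∀ γ δ → γ ∈npc χ → δ ∈afc ζ → emb γ ⌣ emb δ

module Submission where

-- The proof is purely about strings and needs no semantics at all.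
--   * Every string relation used here (x ↝ x′, x ⌣d y and hence x ⌣ y)
--     only inspects a finite prefix of its arguments and fixes the rest,
--     so it is preserved when both sides are extended by arbitrary
--     suffixes; i.e. ⌣ is upward closed under the prefix order ≼.
--   * The static component of a synchron is, by definition, a prefix of
--     its argument list, hence (embedded as a string) a prefix of the
--     synchron's string.
-- Given a pair ς ∈ nς(χ), υ ∈ aς(ζ), the hypothesis χ ⌣•s ζ applied to
-- their static components gives  c(ς) ⌣ c(υ), and upward closure lifts
-- this to  ς ⌣ υ.

open import Defs
open import Data.Bool using (T; true; false)
open import Data.Product using (Σ; _,_)
open import Data.Sum using (inj₁; inj₂)
open import Data.List using (List; []; _∷_; _++_; [_]; map)
open import Data.List.Properties using (++-assoc; map-++)
open import Relation.Binary.PropositionalEquality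
  using (_≡_; refl; cong)

module Prefix where

  infix 4 _≼_
  _≼_ : ∀ {a} {A : Set a} → List A → List A → Set a
  xs ≼ ys = Σ _ λ zs → ys ≡ xs ++ zs

  ≼-++ : ∀ {a} {A : Set a} (xs zs : List A) → xs ≼ xs ++ zs
  ≼-++ xs zs = zs , refl

  ≼-trans : ∀ {a} {A : Set a} {xs ys zs : List A} → xs ≼ ys → ys ≼ zs → xs ≼ zs
  ≼-trans {xs = xs} (us , refl) (vs , refl) = us ++ vs , ++-assoc xs us vs

  ≼-map : ∀ {a b} {A : Set a} {B : Set b} (f : A → B) {xs ys : List A} →
          xs ≼ ys → map f xs ≼ map f ys
  ≼-map f {xs} (zs , refl) = map f zs , map-++ f xs zs

open Prefix

module Strings {𝒜 𝒞 ℬ 𝒮 : Set} {k : Calc} where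
  open Syntax 𝒜 𝒞 ℬ 𝒮 k

  -- x ↝ x′ rewrites only the part of x before a |-argument, so it is
  -- stable under appending a common suffix.
  ↝-++ : ∀ {x x′} t → x ↝ x′ → (x ++ t) ↝ (x′ ++ t)
  ↝-++ t (inj₁ refl) = inj₁ refl
  ↝-++ t (inj₂ (σ₁ , D , x₂ , refl , refl)) =
    inj₂ (σ₁ , D , x₂ ++ t , ++-assoc (emb σ₁) _ t , ++-assoc (emb (static σ₁)) _ t)

  -- x ⌣d y only constrains the common prefix up to the diverging
  -- |-arguments, so the two sides may be extended independently.
  ⌣d-++ : ∀ {x y} s t → x ⌣d y → (x ++ s) ⌣d (y ++ t)
  ⌣d-++ s t (σ₁ , D , E , x₂ , y₂ , D≢E , refl , refl) =
    σ₁ , D , E , x₂ ++ s , y₂ ++ t , D≢E , ++-assoc (emb σ₁) _ s , ++-assoc (emb σ₁) _ t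

  ⌣-mono : ∀ {x x′ y y′} → x ≼ x′ → y ≼ y′ → x ⌣ y → x′ ⌣ y′
  ⌣-mono (s , refl) (t , refl) (x₀ , y₀ , x₀↝x , x₀⌣dy₀ , y₀↝y) =
    x₀ ++ s , y₀ ++ t , ↝-++ s x₀↝x , ⌣d-++ s t x₀⌣dy₀ , ↝-++ t y₀↝y

  staticPrefix-≼ : ∀ σ → staticPrefix σ ≼ σ
  staticPrefix-≼ [] = ≼-++ [] []
  staticPrefix-≼ (a ∷ σ) with isStatic a
  ... | true  = let zs , eq = staticPrefix-≼ σ in zs , cong (a ∷_) eq
  ... | false = ≼-++ [] (a ∷ σ)

  cmp-≼-str : ∀ ς → emb (cmp ς) ≼ str ς
  cmp-≼-str (σ ⦅ b ⦆) = ≼-trans (≼-map inj₁ (staticPrefix-≼ σ)) (≼-++ (emb σ) [ inj₂ b ])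

  cmp-⌣⇒⌣ : ∀ ς υ → emb (cmp ς) ⌣ emb (cmp υ) → str ς ⌣ str υ
  cmp-⌣⇒⌣ ς υ = ⌣-mono (cmp-≼-str ς) (cmp-≼-str υ)

proposition7 : ∀ {𝒜 𝒞 ℬ 𝒮 : Set} (k : Calc) (def : 𝒜 → Syntax.Proc 𝒜 𝒞 ℬ 𝒮 k)
    → (T (hasB k) → ∀ A → Syntax.Guarded 𝒜 𝒞 ℬ 𝒮 k (def A))
    → (χ : Semantics.TrS {def = def}) (ζ : Semantics.Tr {def = def})
    → Semantics._⌣•s_ χ ζ → Semantics._⌣•_ χ ζ
proposition7 _ _ _ χ ζ χ⌣•sζ ς υ ς∈nςχ υ∈aςζ =
  Strings.cmp-⌣⇒⌣ ς υ (χ⌣•sζ _ _ (ς , ς∈nςχ , refl) (υ , υ∈aςζ , refl))
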